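{- Let $G$ be a finite simple cubic totally silver graph which contains a $3$--cycle, with $|V(G)|>4$. Then $G$ can be reduced to a cubic totally silver graph on $|V(G)|-4$ vertices; that is, there is a cubic totally silver graph $G'$ obtained from $G$ by deleting four vertices together with their incident edges and adding some new edges between remaining vertices.
   Context: A totally silver coloring of a graph $G$ is a map $c$ from $V(G)$ to a set of colors such that for every $v\in V(G)$, each color appears exactly once on the closed neighborhood $N[v]$; a graph is totally silver if it admits one. Cubic means $3$--regular. -}

module Defs where

open import Data.Nat using (ℕ; _+_; _>_)
open import Data.Fin using (Fin)
open import Data.Product using (Σ; ∃; ∃-syntax; _×_; _,_)
open import Data.Sum using (_⊎_)
open import Relation.Nullary using (¬_; Dec)
open import Relation.Binary.PropositionalEquality using (_≡_; _≢_)
open import Function.Bundles using (_⇔_)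
open import Function.Definitions using (Injective)

record Graph (n : ℕ) : Set₁ where
  field
    Adj   : Fin n → Fin n → Set
    adj?  : ∀ u v → Dec (Adj u v)
    sym   : ∀ {u v} → Adj u v → Adj v u
    irrefl : ∀ {u} → ¬ Adj u u
open Graph public

Cubic : ∀ {n} → Graph n → Set
Cubic {n} G = ∀ v → ∃[ a ] ∃[ b ] ∃[ c ]
  (a ≢ b × a ≢ c × b ≢ c ×
   (∀ x → Adj G v x ⇔ (x ≡ a ⊎ x ≡ b ⊎ x ≡ c)))

InClosedNbhd : ∀ {n} → Graph n → Fin n → Fin n → Set
InClosedNbhd G v u = u ≡ v ⊎ Adj G v u

IsTotallySilverColoring : ∀ {n} → Graph n → {C : Set} → (Fin n → C) → Set
IsTotallySilverColoring {n} G {C} col = ∀ (v : Fin n) (k : C) →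
  ∃[ u ] (InClosedNbhd G v u × col u ≡ k ×
          (∀ w → InClosedNbhd G v w → col w ≡ k → w ≡ u))

TotallySilver : ∀ {n} → Graph n → Set₁
TotallySilver {n} G = Σ Set λ C → Σ (Fin n → C) λ col → IsTotallySilverColoring G col

HasTriangle : ∀ {n} → Graph n → Set
HasTriangle G = ∃[ a ] ∃[ b ] ∃[ c ] (Adj G a b × Adj G b c × Adj G a c)

-- G' (on m vertices, m + 4 = n) is obtained from G by deleting four vertices
-- with their incident edges and adding some new edges among the remaining
-- vertices: ι embeds V(G') injectively as the remaining vertices of G
-- (its image misses exactly 4 vertices by counting), and every edge of G
-- between remaining vertices is kept in G'.
ObtainedByDeleting4 : ∀ {m n} → Graph n → Graph m → Set
ObtainedByDeleting4 {m} {n} G G' = m + 4 ≡ n × Σ (Fin m → Fin n) λ ι →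
  Injective _≡_ _≡_ ι × (∀ u v → Adj G (ι u) (ι v) → Adj G' u v)

module Submission where

-- Fix a totally silver colouring col of G and any vertex a; since G is cubic,
-- the closed neighbourhood N[a] has four vertices and shows every colour exactly
-- once.  Every vertex x therefore has a unique "twin" in N[a] of the same
-- colour.  Delete N[a] and join two remaining vertices x, y when they were
-- adjacent in G, or when x is adjacent to the twin of y and y to the twin of x.
-- The restriction of col stays totally silver on the new graph G': we check the
-- local characterisation of silver colourings (neighbours avoid one's own
-- colour, have pairwise distinct colours, and realise every other colour).
-- Cubicity of G' is then automatic: a silver colouring drawn from a palette of
-- four colours forces every vertex to have exactly three neighbours.

open import Defs
open import Data.Nat using (ℕ; _+_; _>_; suc; zero; s≤s)
open import Data.Nat.Properties using (+-comm)
open import Data.Product using (Σ; _×_; _,_; proj₁; proj₂; ∃; ∃-syntax)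
open import Data.Sum using (_⊎_; inj₁; inj₂)
open import Data.Empty using (⊥; ⊥-elim)
open import Data.Fin using (Fin; zero; suc; punchIn; punchOut; _≟_)
open import Data.Fin.Properties using (suc-injective; punchIn-injective; punchInᵢ≢i; punchIn-punchOut)
open import Function using (_∘_)
open import Relation.Nullary using (¬_; Dec; yes; no)
open import Relation.Nullary.Decidable.Core using (_⊎-dec_)
open import Relation.Binary.PropositionalEquality
  using (_≡_; _≢_; refl; trans; cong; subst) renaming (sym to ≡-sym)
open import Function.Bundles using (_⇔_; mk⇔; Equivalence)
open import Function.Definitions using (Injective)

record Enumeration (m n : ℕ) (P : Fin n → Set) : Set where
  field
    ι         : Fin m → Fin n
    injective : Injective _≡_ _≡_ ι
    avoids    : ∀ u → ¬ P (ι u)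
    covers    : ∀ x → ¬ P x → ∃[ u ] ι u ≡ x

enumerate-all : ∀ n → Enumeration n n (λ _ → ⊥)
enumerate-all n = record
  { ι = λ x → x ; injective = λ e → e ; avoids = λ _ () ; covers = λ x _ → x , refl }

enumerate-without : ∀ {k n} {P : Fin n → Set} → Enumeration (suc k) n P →
  (p : Fin n) → ¬ P p → Enumeration k n (λ x → P x ⊎ x ≡ p)
enumerate-without {k} {n} {P} E p p∉P = record
  { ι = ι′ ; injective = injective′ ; avoids = avoids′ ; covers = covers′ }
  where
  open Enumeration E
  u₀ : Fin (suc k)
  u₀ = proj₁ (covers p p∉P)
  ιu₀≡p : ι u₀ ≡ p
  ιu₀≡p = proj₂ (covers p p∉P)
  ι′ : Fin k → Fin n
  ι′ u = ι (punchIn u₀ u)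
  injective′ : Injective _≡_ _≡_ ι′
  injective′ {x} {y} e = punchIn-injective u₀ x y (injective e)
  avoids′ : ∀ u → ¬ (P (ι′ u) ⊎ ι′ u ≡ p)
  avoids′ u (inj₁ q) = avoids _ q
  avoids′ u (inj₂ e) = punchInᵢ≢i u₀ u (injective (trans e (≡-sym ιu₀≡p)))
  covers′ : ∀ x → ¬ (P x ⊎ x ≡ p) → ∃[ u ] ι′ u ≡ x
  covers′ x x∉ with covers x (x∉ ∘ inj₁)
  ... | v , ιv≡x = punchOut u₀≢v , trans (cong ι (punchIn-punchOut u₀≢v)) ιv≡x
    where
    u₀≢v : u₀ ≢ v
    u₀≢v e = x∉ (inj₂ (trans (≡-sym ιv≡x) (trans (cong ι (≡-sym e)) ιu₀≡p)))

enumerate-cong : ∀ {m n} {P Q : Fin n → Set} →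
  (∀ x → P x → Q x) → (∀ x → Q x → P x) → Enumeration m n P → Enumeration m n Q
enumerate-cong P⇒Q Q⇒P E = record
  { ι = ι ; injective = injective
  ; avoids = λ u q → avoids u (Q⇒P _ q) ; covers = λ x q∉ → covers x (q∉ ∘ P⇒Q x) }
  where open Enumeration E

enumerate-without-image : ∀ k {m n} {P : Fin n → Set} (f : Fin k → Fin n) →
  Injective _≡_ _≡_ f → (∀ i → ¬ P (f i)) → Enumeration (k + m) n P →
  Enumeration m n (λ x → P x ⊎ ∃[ i ] f i ≡ x)
enumerate-without-image zero f _ _ E = enumerate-cong (λ _ → inj₁) drop-empty E
  where
  drop-empty : ∀ x → _ ⊎ ∃[ i ] f i ≡ x → _
  drop-empty x (inj₁ p) = p
  drop-empty x (inj₂ (() , _))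
enumerate-without-image (suc k) {P = P} f f-inj f∉P E =
  enumerate-cong regroup ungroup
    (enumerate-without-image k (f ∘ suc) (suc-injective ∘ f-inj) avoids-rest
      (enumerate-without E (f zero) (f∉P zero)))
  where
  avoids-rest : ∀ i → ¬ (P (f (suc i)) ⊎ f (suc i) ≡ f zero)
  avoids-rest i (inj₁ p) = f∉P (suc i) p
  avoids-rest i (inj₂ e) with f-inj e
  ... | ()
  regroup : ∀ x → (P x ⊎ x ≡ f zero) ⊎ ∃[ i ] f (suc i) ≡ x → P x ⊎ ∃[ i ] f i ≡ x
  regroup x (inj₁ (inj₁ p)) = inj₁ p
  regroup x (inj₁ (inj₂ e)) = inj₂ (zero , ≡-sym e)
  regroup x (inj₂ (i , e)) = inj₂ (suc i , e)
  ungroup : ∀ x → P x ⊎ ∃[ i ] f i ≡ x → (P x ⊎ x ≡ f zero) ⊎ ∃[ i ] f (suc i) ≡ x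
  ungroup x (inj₁ p) = inj₁ (inj₁ p)
  ungroup x (inj₂ (zero , e)) = inj₁ (inj₂ (≡-sym e))
  ungroup x (inj₂ (suc i , e)) = inj₂ (i , e)

module Silver {n} (G : Graph n) {C : Set} (col : Fin n → C)
  (silver : IsTotallySilverColoring G col) where

  colour-injective : ∀ v {y z} → InClosedNbhd G v y → InClosedNbhd G v z →
    col y ≡ col z → y ≡ z
  colour-injective v {y} y∈ z∈ e with silver v (col y)
  ... | _ , _ , _ , unique = trans (unique y y∈ refl) (≡-sym (unique _ z∈ (≡-sym e)))

  adjacent-colours-differ : ∀ {u w} → Adj G u w → col w ≢ col u
  adjacent-colours-differ {u} u~w e =
    irrefl G (subst (Adj G u) (colour-injective u (inj₂ u~w) (inj₁ refl) e) u~w)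

  neighbour-of-colour : ∀ u k → col u ≢ k → ∃[ w ] (Adj G u w × col w ≡ k)
  neighbour-of-colour u k cu≢k with silver u k
  ... | w , inj₁ w≡u , cw , _ = ⊥-elim (cu≢k (trans (cong col (≡-sym w≡u)) cw))
  ... | w , inj₂ u~w , cw , _ = w , u~w , cw

-- Conversely these three local properties characterise silver colourings
-- (given decidable colour comparisons, needed to split off one's own colour).
silver-from-local : ∀ {m} (H : Graph m) {C : Set} (col : Fin m → C) →
  (∀ u k → Dec (col u ≡ k)) →
  (∀ {u w} → Adj H u w → col w ≢ col u) →
  (∀ {u w w′} → Adj H u w → Adj H u w′ → col w ≡ col w′ → w ≡ w′) →
  (∀ u k → col u ≢ k → ∃[ w ] (Adj H u w × col w ≡ k)) →
  IsTotallySilverColoring H col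
silver-from-local H col colour? differ distinct realised u k with colour? u k
... | yes cu≡k = u , inj₁ refl , cu≡k , only-u
  where
  only-u : ∀ w → InClosedNbhd H u w → col w ≡ k → w ≡ u
  only-u w (inj₁ w≡u) _ = w≡u
  only-u w (inj₂ u~w) cw = ⊥-elim (differ u~w (trans cw (≡-sym cu≡k)))
... | no cu≢k with realised u k cu≢k
... | w , u~w , cw = w , inj₂ u~w , cw , only-w
  where
  only-w : ∀ w′ → InClosedNbhd H u w′ → col w′ ≡ k → w′ ≡ w
  only-w w′ (inj₁ refl) cw′ = ⊥-elim (cu≢k cw′)
  only-w w′ (inj₂ u~w′) cw′ = distinct u~w′ u~w (trans cw′ (≡-sym cw))

record Palette {m} {C : Set} (col : Fin m → C) (k : ℕ) : Set where
  field
    colour   : Fin k → C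
    distinct : Injective _≡_ _≡_ colour
    covers   : ∀ v → ∃[ i ] col v ≡ colour i

palette-restrict : ∀ {m n k} {C : Set} {col : Fin n → C} →
  Palette col k → (ι : Fin m → Fin n) → Palette (col ∘ ι) k
palette-restrict pal ι = record { colour = colour ; distinct = distinct ; covers = covers ∘ ι }
  where open Palette pal

closed-nbhd-palette : ∀ {n k} (G : Graph n) {C : Set} {col : Fin n → C} →
  IsTotallySilverColoring G col → (a : Fin n) (vertex : Fin k → Fin n) →
  Injective _≡_ _≡_ vertex → (∀ i → InClosedNbhd G a (vertex i)) →
  (∀ x → InClosedNbhd G a x → ∃[ i ] vertex i ≡ x) → Palette col k
closed-nbhd-palette G {col = col} silver a vertex vertex-inj vertex∈ lists = record
  { colour = col ∘ vertex
  ; distinct = λ e → vertex-inj (colour-injective a (vertex∈ _) (vertex∈ _) e)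
  ; covers = covers }
  where
  open Silver G col silver
  covers : ∀ v → ∃[ i ] col v ≡ col (vertex i)
  covers v with silver a (col v)
  ... | t , t∈ , ct , _ with lists t t∈
  ... | i , vi≡t = i , trans (≡-sym ct) (cong col (≡-sym vi≡t))

-- A silver colouring with a palette of four colours forces degree three: the
-- neighbours of u are exactly the vertices carrying the three other colours.
palette⇒cubic : ∀ {m} (H : Graph m) {C : Set} {col : Fin m → C} →
  IsTotallySilverColoring H col → Palette col 4 → Cubic H
palette⇒cubic {m} H {C} {col} silver pal u with Palette.covers pal u
... | i , cu≡ =
  nb zero , nb (suc zero) , nb (suc (suc zero)) ,
  nb-distinct (λ ()) , nb-distinct (λ ()) , nb-distinct (λ ()) ,
  λ x → mk⇔ (to x) (from x)
  where
  open Silver H col silver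
  open Palette pal
  other : Fin 3 → C
  other j = colour (punchIn i j)
  other≢ : ∀ j → col u ≢ other j
  other≢ j e = punchInᵢ≢i i j (≡-sym (distinct (trans (≡-sym cu≡) e)))
  nb : Fin 3 → Fin m
  nb j = proj₁ (neighbour-of-colour u (other j) (other≢ j))
  nb-adj : ∀ j → Adj H u (nb j)
  nb-adj j = proj₁ (proj₂ (neighbour-of-colour u (other j) (other≢ j)))
  nb-colour : ∀ j → col (nb j) ≡ other j
  nb-colour j = proj₂ (proj₂ (neighbour-of-colour u (other j) (other≢ j)))
  nb-distinct : ∀ {j j′} → j ≢ j′ → nb j ≢ nb j′
  nb-distinct {j} {j′} j≢j′ e = j≢j′ (punchIn-injective i j j′
    (distinct (trans (≡-sym (nb-colour j)) (trans (cong col e) (nb-colour j′)))))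
  by-index : ∀ {x} j → x ≡ nb j → x ≡ nb zero ⊎ x ≡ nb (suc zero) ⊎ x ≡ nb (suc (suc zero))
  by-index zero e = inj₁ e
  by-index (suc zero) e = inj₂ (inj₁ e)
  by-index (suc (suc zero)) e = inj₂ (inj₂ e)
  to : ∀ x → Adj H u x → x ≡ nb zero ⊎ x ≡ nb (suc zero) ⊎ x ≡ nb (suc (suc zero))
  to x u~x with covers x
  ... | l , cx≡ = by-index (punchOut i≢l)
    (colour-injective u (inj₂ u~x) (inj₂ (nb-adj _))
      (trans cx≡ (trans (cong colour (≡-sym (punchIn-punchOut i≢l))) (≡-sym (nb-colour _)))))
    where
    i≢l : i ≢ l
    i≢l e = adjacent-colours-differ u~x (trans cx≡ (trans (cong colour (≡-sym e)) (≡-sym cu≡)))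
  from : ∀ x → x ≡ nb zero ⊎ x ≡ nb (suc zero) ⊎ x ≡ nb (suc (suc zero)) → Adj H u x
  from x (inj₁ refl) = nb-adj zero
  from x (inj₂ (inj₁ refl)) = nb-adj (suc zero)
  from x (inj₂ (inj₂ refl)) = nb-adj (suc (suc zero))

module CubicVertex {n} (G : Graph n) (a p q r : Fin n)
  (p≢q : p ≢ q) (p≢r : p ≢ r) (q≢r : q ≢ r)
  (nbhd : ∀ x → Adj G a x ⇔ (x ≡ p ⊎ x ≡ q ⊎ x ≡ r)) where

  neighbour : Fin 3 → Fin n
  neighbour zero = p
  neighbour (suc zero) = q
  neighbour (suc (suc zero)) = r

  neighbour-adj : ∀ i → Adj G a (neighbour i)
  neighbour-adj zero = Equivalence.from (nbhd p) (inj₁ refl)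
  neighbour-adj (suc zero) = Equivalence.from (nbhd q) (inj₂ (inj₁ refl))
  neighbour-adj (suc (suc zero)) = Equivalence.from (nbhd r) (inj₂ (inj₂ refl))

  neighbour-injective : Injective _≡_ _≡_ neighbour
  neighbour-injective {zero} {zero} _ = refl
  neighbour-injective {zero} {suc zero} e = ⊥-elim (p≢q e)
  neighbour-injective {zero} {suc (suc zero)} e = ⊥-elim (p≢r e)
  neighbour-injective {suc zero} {zero} e = ⊥-elim (p≢q (≡-sym e))
  neighbour-injective {suc zero} {suc zero} _ = refl
  neighbour-injective {suc zero} {suc (suc zero)} e = ⊥-elim (q≢r e)
  neighbour-injective {suc (suc zero)} {zero} e = ⊥-elim (p≢r (≡-sym e))
  neighbour-injective {suc (suc zero)} {suc zero} e = ⊥-elim (q≢r (≡-sym e))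
  neighbour-injective {suc (suc zero)} {suc (suc zero)} _ = refl

  a≢neighbour : ∀ i → a ≢ neighbour i
  a≢neighbour i e = irrefl G (subst (Adj G a) (≡-sym e) (neighbour-adj i))

  vertex : Fin 4 → Fin n
  vertex zero = a
  vertex (suc i) = neighbour i

  vertex-injective : Injective _≡_ _≡_ vertex
  vertex-injective {zero} {zero} _ = refl
  vertex-injective {zero} {suc j} e = ⊥-elim (a≢neighbour j e)
  vertex-injective {suc i} {zero} e = ⊥-elim (a≢neighbour i (≡-sym e))
  vertex-injective {suc i} {suc j} e = cong suc (neighbour-injective e)

  vertex∈ : ∀ i → InClosedNbhd G a (vertex i)
  vertex∈ zero = inj₁ refl
  vertex∈ (suc i) = inj₂ (neighbour-adj i)

  lists : ∀ x → InClosedNbhd G a x → ∃[ i ] vertex i ≡ x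
  lists x (inj₁ x≡a) = zero , ≡-sym x≡a
  lists x (inj₂ a~x) with Equivalence.to (nbhd x) a~x
  ... | inj₁ e = suc zero , ≡-sym e
  ... | inj₂ (inj₁ e) = suc (suc zero) , ≡-sym e
  ... | inj₂ (inj₂ e) = suc (suc (suc zero)) , ≡-sym e

  enumerate-outside : ∀ {m} → n ≡ 4 + m → Enumeration m n (InClosedNbhd G a)
  enumerate-outside refl =
    enumerate-cong to-nbhd from-nbhd
      (enumerate-without-image 4 vertex vertex-injective (λ _ ()) (enumerate-all _))
    where
    to-nbhd : ∀ x → ⊥ ⊎ ∃[ i ] vertex i ≡ x → InClosedNbhd G a x
    to-nbhd x (inj₂ (i , refl)) = vertex∈ i
    from-nbhd : ∀ x → InClosedNbhd G a x → ⊥ ⊎ ∃[ i ] vertex i ≡ x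
    from-nbhd x x∈ = inj₂ (lists x x∈)

module Reduction {n} (G : Graph n) {C : Set} (col : Fin n → C)
  (silver : IsTotallySilverColoring G col) (a : Fin n) where

  open Silver G col silver

  Deleted : Fin n → Set
  Deleted = InClosedNbhd G a

  deleted? : ∀ x → Dec (Deleted x)
  deleted? x = (x ≟ a) ⊎-dec adj? G a x

  delegate : C → Fin n
  delegate k = proj₁ (silver a k)

  delegate-deleted : ∀ k → Deleted (delegate k)
  delegate-deleted k = proj₁ (proj₂ (silver a k))

  delegate-colour : ∀ k → col (delegate k) ≡ k
  delegate-colour k = proj₁ (proj₂ (proj₂ (silver a k)))

  delegate-unique : ∀ {s} → Deleted s → delegate (col s) ≡ s
  delegate-unique {s} s∈ = colour-injective a (delegate-deleted _) s∈ (delegate-colour (col s))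

  -- Since all colours are represented in N[a], colours can be compared.
  colour? : ∀ x k → Dec (col x ≡ k)
  colour? x k with delegate (col x) ≟ delegate k
  ... | yes e = yes (trans (≡-sym (delegate-colour _)) (trans (cong col e) (delegate-colour k)))
  ... | no ne = no (ne ∘ cong delegate)

  twin : Fin n → Fin n
  twin x = delegate (col x)

  NewAdj : Fin n → Fin n → Set
  NewAdj x y = Adj G x y ⊎ (Adj G x (twin y) × Adj G y (twin x))

  new-adj? : ∀ x y → Dec (NewAdj x y)
  new-adj? x y with adj? G x y | adj? G x (twin y) | adj? G y (twin x)
  ... | yes x~y | _ | _ = yes (inj₁ x~y)
  ... | no x≁y | yes p | yes q = yes (inj₂ (p , q))
  ... | no x≁y | no ¬p | _ = no λ { (inj₁ x~y) → x≁y x~y ; (inj₂ (p , _)) → ¬p p }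
  ... | no x≁y | yes _ | no ¬q = no λ { (inj₁ x~y) → x≁y x~y ; (inj₂ (_ , q)) → ¬q q }

  new-sym : ∀ {x y} → NewAdj x y → NewAdj y x
  new-sym (inj₁ x~y) = inj₁ (Graph.sym G x~y)
  new-sym (inj₂ (p , q)) = inj₂ (q , p)

  -- A vertex is never adjacent to its own twin, which has its colour.
  new-irrefl : ∀ {x} → ¬ NewAdj x x
  new-irrefl (inj₁ x~x) = irrefl G x~x
  new-irrefl {x} (inj₂ (x~twin , _)) = adjacent-colours-differ x~twin (delegate-colour (col x))

  new-neighbour-colour-differs : ∀ {x w} → ¬ Deleted x → NewAdj x w → col w ≢ col x
  new-neighbour-colour-differs _ (inj₁ x~w) = adjacent-colours-differ x~w
  new-neighbour-colour-differs {x} {w} x∉ (inj₂ (x~twin , _)) e =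
    x∉ (subst Deleted twin≡x (delegate-deleted _))
    where
    twin≡x : twin w ≡ x
    twin≡x = colour-injective x (inj₂ x~twin) (inj₁ refl) (trans (delegate-colour _) e)

  new-neighbour-colours-distinct : ∀ {x w₁ w₂} → ¬ Deleted w₁ → ¬ Deleted w₂ →
    NewAdj x w₁ → NewAdj x w₂ → col w₁ ≡ col w₂ → w₁ ≡ w₂
  new-neighbour-colours-distinct {x} _ _ (inj₁ x~w₁) (inj₁ x~w₂) e =
    colour-injective x (inj₂ x~w₁) (inj₂ x~w₂) e
  new-neighbour-colours-distinct {x} w₁∉ _ (inj₁ x~w₁) (inj₂ (x~twin , _)) e =
    ⊥-elim (w₁∉ (subst Deleted (colour-injective x (inj₂ x~twin) (inj₂ x~w₁)
      (trans (delegate-colour _) (≡-sym e))) (delegate-deleted _)))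
  new-neighbour-colours-distinct {x} _ w₂∉ (inj₂ (x~twin , _)) (inj₁ x~w₂) e =
    ⊥-elim (w₂∉ (subst Deleted (colour-injective x (inj₂ x~twin) (inj₂ x~w₂)
      (trans (delegate-colour _) e)) (delegate-deleted _)))
  new-neighbour-colours-distinct {x} _ _ (inj₂ (_ , w₁~twin)) (inj₂ (_ , w₂~twin)) e =
    colour-injective (twin x) (inj₂ (Graph.sym G w₁~twin)) (inj₂ (Graph.sym G w₂~twin)) e

  -- Every other colour k appears on a surviving new neighbour of x: either on
  -- an old neighbour outside N[a], or else the twin of x has a neighbour w₁ of
  -- colour k outside N[a], and x sees the twin of w₁.
  new-neighbour-of-colour : ∀ x k → ¬ Deleted x → col x ≢ k →
    ∃[ w ] (¬ Deleted w × NewAdj x w × col w ≡ k)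
  new-neighbour-of-colour x k x∉ cx≢k with neighbour-of-colour x k cx≢k
  ... | w₀ , x~w₀ , cw₀ with deleted? w₀
  ... | no w₀∉ = w₀ , w₀∉ , inj₁ x~w₀ , cw₀
  ... | yes w₀∈ with neighbour-of-colour (twin x) k (cx≢k ∘ trans (≡-sym (delegate-colour _)))
  ... | w₁ , twin~w₁ , cw₁ = w₁ , w₁∉ , inj₂ (x~twin-w₁ , Graph.sym G twin~w₁) , cw₁
    where
    twin-w₁≡w₀ : twin w₁ ≡ w₀
    twin-w₁≡w₀ = trans (cong delegate (trans cw₁ (≡-sym cw₀))) (delegate-unique w₀∈)
    x~twin-w₁ : Adj G x (twin w₁)
    x~twin-w₁ = subst (Adj G x) (≡-sym twin-w₁≡w₀) x~w₀
    -- Otherwise w₁ = w₀ would see both x and its twin, which share a colour.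
    w₁∉ : ¬ Deleted w₁
    w₁∉ w₁∈ = x∉ (subst Deleted twin≡x (delegate-deleted _))
      where
      w₁≡w₀ : w₁ ≡ w₀
      w₁≡w₀ = colour-injective a w₁∈ w₀∈ (trans cw₁ (≡-sym cw₀))
      twin≡x : twin x ≡ x
      twin≡x = colour-injective w₀
        (inj₂ (subst (λ w → Adj G w (twin x)) w₁≡w₀ (Graph.sym G twin~w₁)))
        (inj₂ (Graph.sym G x~w₀)) (delegate-colour (col x))

  module Reduced {m} (E : Enumeration m n Deleted) where
    open Enumeration E

    G′ : Graph m
    G′ = record
      { Adj = λ u v → NewAdj (ι u) (ι v) ; adj? = λ u v → new-adj? (ι u) (ι v)
      ; sym = new-sym ; irrefl = new-irrefl }

    keeps-old-edges : ∀ u v → Adj G (ι u) (ι v) → Adj G′ u v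
    keeps-old-edges u v = inj₁

    silver′ : IsTotallySilverColoring G′ (col ∘ ι)
    silver′ = silver-from-local G′ (col ∘ ι) (colour? ∘ ι)
      (λ {u} → new-neighbour-colour-differs (avoids u))
      (λ {_} {w} {w′} u~w u~w′ e →
        injective (new-neighbour-colours-distinct (avoids w) (avoids w′) u~w u~w′ e))
      realised
      where
      realised : ∀ u k → col (ι u) ≢ k → ∃[ v ] (Adj G′ u v × col (ι v) ≡ k)
      realised u k cu≢k with new-neighbour-of-colour (ι u) k (avoids u) cu≢k
      ... | w , w∉ , u~w , cw with covers w w∉
      ... | v , refl = v , u~w , cw

mainTheorem9 : ∀ (n : ℕ) (G : Graph n) → Cubic G → TotallySilver G →
    HasTriangle G → n > 4 →
    Σ ℕ λ m → Σ (Graph m) λ G' →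
    ObtainedByDeleting4 G G' × Cubic G' × TotallySilver G'
mainTheorem9 (suc (suc (suc (suc m)))) G cubic (C , col , silver) (a , _) _
  with cubic a
... | p , q , r , p≢q , p≢r , q≢r , nbhd =
  m , G′ , (+-comm m 4 , ι , injective , keeps-old-edges) ,
  palette⇒cubic G′ silver′ (palette-restrict palette ι) , (C , col ∘ ι , silver′)
  where
  open CubicVertex G a p q r p≢q p≢r q≢r nbhd
  palette : Palette col 4
  palette = closed-nbhd-palette G silver a vertex vertex-injective vertex∈ lists
  E : Enumeration m _ (InClosedNbhd G a)
  E = enumerate-outside refl
  open Enumeration E using (ι; injective)
  open Reduction G col silver a
  open Reduced E
mainTheorem9 zero G _ _ _ ()
mainTheorem9 (suc zero) G _ _ _ (s≤s ())
mainTheorem9 (suc (suc zero)) G _ _ _ (s≤s (s≤s ()))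
mainTheorem9 (suc (suc (suc zero))) G _ _ _ (s≤s (s≤s (s≤s ())))
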